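{- For every family $(C_n)_{n\in\mathbb{N}}$ of arithmetic circuits over $\mathbb{R}$ of polynomial size and constant depth, each having a single output gate, there exists a family $(C'_n)_{n\in\mathbb{N}}$ of tree-like arithmetic circuits over $\mathbb{R}$ of polynomial size and constant depth computing the same function, such that for all $n\in\mathbb{N}$ and every gate $v$ of $C'_n$, every path from an input gate to $v$ has the same length.
   Context: An arithmetic circuit over $\mathbb{R}$ is a finite directed acyclic graph (no multiple edges) whose gates are: input gates (indegree 0, holding the input values), constant gates (indegree 0, labelled by real numbers), addition and multiplication gates of arbitrary indegree, sign gates (indegree 1, computing $\mathrm{sign}(x)\in\{1,0,-1\}$ for $x>0,=0,<0$), and output gates (indegree 1). The circuit computes the function given by evaluating all gates; size is the number of gates, depth the length of the longest path from an input gate to an output gate. A circuit family $(C_n)$ has one circuit $C_n$ with $n$ input gates for each $n$ and computes $x\mapsto f_{C_{|x|}}(x)$; it has polynomial size if the size of $C_n$ is bounded by a polynomial in $n$ and constant depth if the depth is bounded by a constant. A circuit is tree-like if it is a directed tree (rooted at the output gate) except that input gates may have several successors, i.e., the graph becomes a tree if each input gate is duplicated for each of its outgoing edges. -}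

module Defs where

open import Level using (Level; _⊔_)
open import Data.Nat using (ℕ; zero; suc; _+_; _*_; _^_; _≤_)
open import Data.Fin using (Fin; zero; suc)
open import Data.Vec using (Vec; []; _∷_; lookup)
open import Data.Bool using (Bool; true; false)
open import Data.Product using (Σ; ∃; ∃-syntax; _×_; _,_)
open import Relation.Nullary using (¬_)
import Relation.Nullary
import Data.Fin
open import Relation.Binary.PropositionalEquality using (_≡_)
open import Algebra.Bundles using (CommutativeRing)

-- Arithmetic circuits over an (arbitrary) commutative ring R with a
-- "sign" operation (the paper: R = ℝ, sign : ℝ → {1,0,-1}).
--
-- A circuit with n input variables and s gates is a list of gates in
-- reverse topological order: the head gate (index zero) may only have
-- predecessors among the gates of the tail.  Acyclicity is thus
-- structural, and predecessor sets are subsets (Vec Bool), so there are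
-- no multiple edges.

module Circuits {c ℓ : Level} (R : CommutativeRing c ℓ)
                (sign : CommutativeRing.Carrier R → CommutativeRing.Carrier R) where

  open CommutativeRing R using (Carrier; 0#; 1#) renaming (_+_ to _+R_; _*_ to _*R_)

  -- A gate whose possible predecessors are the k gates below it.
  data Gate (n k : ℕ) : Set c where
    input : Fin n → Gate n k
    const : Carrier → Gate n k
    add   : Vec Bool k → Gate n k
    mul   : Vec Bool k → Gate n k
    sgn   : Fin k → Gate n k
    out   : Fin k → Gate n k

  data Circuit (n : ℕ) : ℕ → Set c where
    []  : Circuit n 0
    _∷_ : ∀ {s} → Gate n s → Circuit n s → Circuit n (suc s)

  data Kind (n : ℕ) : Set c where
    kInput : Fin n → Kind n
    kConst : Carrier → Kind n
    kAdd kMul kSgn kOut : Kind n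

  gateKind : ∀ {n k} → Gate n k → Kind n
  gateKind (input i) = kInput i
  gateKind (const r) = kConst r
  gateKind (add _)   = kAdd
  gateKind (mul _)   = kMul
  gateKind (sgn _)   = kSgn
  gateKind (out _)   = kOut

  kind : ∀ {n s} → Circuit n s → Fin s → Kind n
  kind (g ∷ C) zero    = gateKind g
  kind (g ∷ C) (suc j) = kind C j

  isPred : ∀ {n k} → Gate n k → Fin k → Bool
  isPred (input _) j = false
  isPred (const _) j = false
  isPred (add S)   j = lookup S j
  isPred (mul S)   j = lookup S j
  isPred (sgn i)   j with Data.Fin._≟_ i j
  ... | Relation.Nullary.yes _ = true
  ... | Relation.Nullary.no  _ = false
  isPred (out i)   j with Data.Fin._≟_ i j
  ... | Relation.Nullary.yes _ = true
  ... | Relation.Nullary.no  _ = false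

  edge : ∀ {n s} → Circuit n s → Fin s → Fin s → Bool
  edge (g ∷ C) zero    zero    = false
  edge (g ∷ C) (suc u) zero    = isPred g u
  edge (g ∷ C) zero    (suc v) = false
  edge (g ∷ C) (suc u) (suc v) = edge C u v

  sumSel : ∀ {k} → Vec Bool k → Vec Carrier k → Carrier
  sumSel []          []       = 0#
  sumSel (true  ∷ b) (x ∷ xs) = x +R sumSel b xs
  sumSel (false ∷ b) (x ∷ xs) = sumSel b xs

  prodSel : ∀ {k} → Vec Bool k → Vec Carrier k → Carrier
  prodSel []          []       = 1#
  prodSel (true  ∷ b) (x ∷ xs) = x *R prodSel b xs
  prodSel (false ∷ b) (x ∷ xs) = prodSel b xs

  gateVal : ∀ {n k} → Gate n k → (Fin n → Carrier) → Vec Carrier k → Carrier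
  gateVal (input i) x vs = x i
  gateVal (const r) x vs = r
  gateVal (add S)   x vs = sumSel S vs
  gateVal (mul S)   x vs = prodSel S vs
  gateVal (sgn i)   x vs = sign (lookup vs i)
  gateVal (out i)   x vs = lookup vs i

  values : ∀ {n s} → Circuit n s → (Fin n → Carrier) → Vec Carrier s
  values []      x = []
  values (g ∷ C) x = let vs = values C x in gateVal g x vs ∷ vs

  IsInput : ∀ {n s} → Circuit n s → Fin s → Set c
  IsInput C u = ∃[ i ] (kind C u ≡ kInput i)

  IsOutput : ∀ {n s} → Circuit n s → Fin s → Set c
  IsOutput C u = kind C u ≡ kOut

  InputsOK : ∀ {n s} → Circuit n s → Set c
  InputsOK {n} {s} C =
    (i : Fin n) → ∃[ u ] (kind C u ≡ kInput i × ((u' : Fin s) → kind C u' ≡ kInput i → u' ≡ u))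

  data Path {n s} (C : Circuit n s) : Fin s → Fin s → ℕ → Set where
    here : ∀ {v} → Path C v v 0
    step : ∀ {u w v k} → edge C u w ≡ true → Path C w v k → Path C u v (suc k)

  DepthAtMost : ∀ {n s} → Circuit n s → ℕ → Set c
  DepthAtMost C d = ∀ u v k → IsInput C u → IsOutput C v → Path C u v k → k ≤ d

  TreeLike : ∀ {n s} → Circuit n s → Set c
  TreeLike {n} {s} C = (g : Fin s) → ¬ IsInput C g →
      (IsOutput C g → (w : Fin s) → ¬ (edge C g w ≡ true))
    × (¬ IsOutput C g → ∃[ w ] (edge C g w ≡ true × ((w' : Fin s) → edge C g w' ≡ true → w' ≡ w)))

  Leveled : ∀ {n s} → Circuit n s → Set c
  Leveled C = ∀ u u' v k k' → IsInput C u → IsInput C u' → Path C u v k → Path C u' v k' → k ≡ k'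

  record SOCircuit (n : ℕ) : Set c where
    field
      size      : ℕ
      circ      : Circuit n size
      inputsOK  : InputsOK circ
      output    : Fin size
      outputOK  : IsOutput circ output
      outputUnq : (j : Fin size) → IsOutput circ j → j ≡ output

  open SOCircuit public

  fun : ∀ {n} → SOCircuit n → (Fin n → Carrier) → Carrier
  fun C x = lookup (values (circ C) x) (output C)

  Family : Set c
  Family = (n : ℕ) → SOCircuit n

  PolySize : Family → Set
  PolySize C = ∃[ a ] ∃[ k ] ((n : ℕ) → size (C n) ≤ a * n ^ k + a)

  ConstDepth : Family → Set c
  ConstDepth C = ∃[ d ] ((n : ℕ) → DepthAtMost (circ (C n)) d)

  -- the underlying circuit of a single-output circuit (plain function,
  -- so the module parameters are explicit when used qualified)
  circuitOf : ∀ {n} (C : SOCircuit n) → Circuit n (size C)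
  circuitOf C = circ C

module Submission where

-- Fix a circuit D of size s and depth ≤ d.
--  1. (Formulas) Unfold the output gate of D into a formula, folding every
--     subformula built from constants alone into one constant.  A non-constant
--     node of height j then lies above a path of length ≥ j from an input gate,
--     so the formula has height ≤ d; all its nodes have fan-in ≤ s.
--  2. (Trees) Pad the formula to a leveled tree of height exactly d by pushing
--     variables down through unary additions; it has ≤ (2 + s)^(d+1) nodes.
--  3. (Compilation) Build the tree gate by gate on top of a layer of n input
--     gates shared by all variable leaves, and add an output gate.  Invariants
--     along the construction give tree-likeness (every gate but the root is
--     consumed by exactly one successor), levels (every edge out of a
--     non-constant gate climbs one level) and correctness.
-- The new size (2 + s)^(d+1) + n + 1 is polynomial in n whenever s is
-- (PolynomialBounds) and the new depth is d + 2.  Everything is done over an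
-- arbitrary commutative ring with a sign operation respecting equality.

open import Defs
open import Level using (Level)
import Level
open import Data.Nat using (ℕ; zero; suc; _+_; _*_; _^_; _≤_; _<_; z≤n; s≤s; _⊔_; _≟_; _≤?_)
open import Data.Nat.Properties
  using (≤-refl; ≤-trans; ≤-reflexive; <⇒≤; <-irrefl; ≰⇒>; n≤1+n; m≤n⇒m≤1+n; m≤m+n; m≤n+m;
         +-mono-≤; +-monoˡ-≤; +-monoʳ-≤; *-monoˡ-≤; *-monoʳ-≤; +-assoc; *-mono-≤; *-identityˡ; *-identityʳ;
         *-distribʳ-+; +-suc; +-identityʳ; ^-monoˡ-≤; ^-monoʳ-≤; ^-zeroˡ; ^-distribˡ-+-*;
         m^n>0; m≤m⊔n; m≤n⊔m; ⊔-lub; ≤-pred; ≤∧≢⇒<)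
open import Data.Fin.Properties using (toℕ-injective; toℕ-fromℕ<; toℕ<n)
open import Data.Nat.Tactic.RingSolver using (solve-∀)
open import Data.Fin using (Fin; zero; suc; toℕ; fromℕ<)
open import Data.Vec using (Vec; []; _∷_; lookup; replicate; zipWith)
open import Data.Vec.Properties using (lookup-zipWith; lookup-replicate)
open import Data.List using (List; []; _∷_; length; foldr)
open import Data.List.Membership.Propositional using (_∈_)
open import Data.List.Relation.Unary.Any using (here; there)
open import Data.Maybe using (Maybe; just; nothing)
import Data.Maybe as Maybe
open import Data.Bool using (Bool; true; false; not; _∧_; _∨_; if_then_else_)
open import Data.Unit using (⊤; tt)
open import Data.Empty using (⊥; ⊥-elim)
open import Data.Product using (∃-syntax; _×_; _,_; proj₁; proj₂)
open import Relation.Nullary using (¬_; yes; no)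
open import Relation.Nullary.Decidable using (⌊_⌋)
open import Algebra.Bundles using (CommutativeRing)
import Data.Fin as Fin
open import Relation.Binary.PropositionalEquality using (_≡_; _≢_; refl; sym; trans; cong; cong₂; subst; module ≡-Reasoning)

-- Polynomial bounds in the form  f n ≤ a · (n+1)^k,  which is closed under
-- sums, products and powers without case distinctions on n = 0.
module PolynomialBounds where

  record BoundedBy (a k : ℕ) (f : ℕ → ℕ) : Set where
    constructor bounded
    field bound : ∀ n → f n ≤ a * suc n ^ k

  bounded-const : ∀ a → BoundedBy a 0 (λ _ → a)
  bounded-const a = bounded λ _ → ≤-reflexive (sym (*-identityʳ a))

  bounded-id : BoundedBy 1 1 (λ n → n)
  bounded-id = bounded λ n → ≤-trans (n≤1+n n) (≤-reflexive (sym (trans (*-identityˡ _) (*-identityʳ _))))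

  bounded-+ : ∀ {a b k l f g} → BoundedBy a k f → BoundedBy b l g →
              BoundedBy (a + b) (k + l) (λ n → f n + g n)
  bounded-+ {a} {b} {k} {l} {f} {g} (bounded f≤) (bounded g≤) = bounded λ n → begin
      f n + g n                                 ≤⟨ +-mono-≤ (f≤ n) (g≤ n) ⟩
      a * suc n ^ k + b * suc n ^ l             ≤⟨ +-mono-≤ (*-monoʳ-≤ a (^-monoʳ-≤ (suc n) (m≤m+n k l)))
                                                            (*-monoʳ-≤ b (^-monoʳ-≤ (suc n) (m≤n+m l k))) ⟩
      a * suc n ^ (k + l) + b * suc n ^ (k + l) ≡⟨ sym (*-distribʳ-+ (suc n ^ (k + l)) a b) ⟩
      (a + b) * suc n ^ (k + l)                 ∎
    where open Data.Nat.Properties.≤-Reasoning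

  bounded-* : ∀ {a b k l f g} → BoundedBy a k f → BoundedBy b l g →
              BoundedBy (a * b) (k + l) (λ n → f n * g n)
  bounded-* {a} {b} {k} {l} {f} {g} (bounded f≤) (bounded g≤) = bounded λ n → begin
      f n * g n                           ≤⟨ *-mono-≤ (f≤ n) (g≤ n) ⟩
      (a * suc n ^ k) * (b * suc n ^ l)   ≡⟨ regroup a b (suc n ^ k) (suc n ^ l) ⟩
      (a * b) * (suc n ^ k * suc n ^ l)   ≡⟨ cong ((a * b) *_) (sym (^-distribˡ-+-* (suc n) k l)) ⟩
      (a * b) * suc n ^ (k + l)           ∎
    where
    open Data.Nat.Properties.≤-Reasoning
    regroup : ∀ a b p q → (a * p) * (b * q) ≡ (a * b) * (p * q)
    regroup = solve-∀

  bounded-^ : ∀ {a k f} → BoundedBy a k f → ∀ e → BoundedBy (a ^ e) (e * k) (λ n → f n ^ e)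
  bounded-^ f≤ zero    = bounded λ _ → ≤-refl
  bounded-^ f≤ (suc e) = bounded-* f≤ (bounded-^ f≤ e)

  ^-distribʳ-* : ∀ x y e → (x * y) ^ e ≡ x ^ e * y ^ e
  ^-distribʳ-* x y zero    = refl
  ^-distribʳ-* x y (suc e) = trans (cong (x * y *_) (^-distribʳ-* x y e)) (regroup x y (x ^ e) (y ^ e))
    where
    regroup : ∀ a b c d → a * b * (c * d) ≡ a * c * (b * d)
    regroup = solve-∀

  suc^≤ : ∀ n k → suc n ^ k ≤ 2 ^ k * n ^ k + 2 ^ k
  suc^≤ zero    k = ≤-trans (≤-reflexive (^-zeroˡ k)) (≤-trans (m^n>0 2 k) (m≤n+m (2 ^ k) _))
  suc^≤ (suc n) k = ≤-trans (^-monoˡ-≤ k 2+n≤2*[1+n])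
                      (≤-trans (≤-reflexive (^-distribʳ-* 2 (suc n) k)) (m≤m+n _ _))
    where
    double : ∀ n → suc (suc n) + n ≡ 2 * suc n
    double = solve-∀
    2+n≤2*[1+n] : suc (suc n) ≤ 2 * suc n
    2+n≤2*[1+n] = ≤-trans (m≤m+n (suc (suc n)) n) (≤-reflexive (double n))

  fromPolySize : ∀ {a k f} → (∀ n → f n ≤ a * n ^ k + a) → BoundedBy (a + a) k f
  fromPolySize {a} {k} {f} f≤ = bounded λ n → begin
      f n                               ≤⟨ f≤ n ⟩
      a * n ^ k + a                     ≤⟨ +-mono-≤ (*-monoʳ-≤ a (^-monoˡ-≤ k (n≤1+n n))) (a≤a*[1+n]^k n) ⟩
      a * suc n ^ k + a * suc n ^ k     ≡⟨ sym (*-distribʳ-+ (suc n ^ k) a a) ⟩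
      (a + a) * suc n ^ k               ∎
    where
    open Data.Nat.Properties.≤-Reasoning
    a≤a*[1+n]^k : ∀ n → a ≤ a * suc n ^ k
    a≤a*[1+n]^k n = ≤-trans (≤-reflexive (sym (*-identityʳ a))) (*-monoʳ-≤ a (m^n>0 (suc n) k))

  toPolySize : ∀ {a k f} → BoundedBy a k f → ∃[ a′ ] ∃[ k′ ] (∀ n → f n ≤ a′ * n ^ k′ + a′)
  toPolySize {a} {k} {f} (bounded f≤) = a * 2 ^ k , k , λ n → begin
      f n                               ≤⟨ f≤ n ⟩
      a * suc n ^ k                     ≤⟨ *-monoʳ-≤ a (suc^≤ n k) ⟩
      a * (2 ^ k * n ^ k + 2 ^ k)       ≡⟨ distrib a (2 ^ k) (n ^ k) ⟩
      (a * 2 ^ k) * n ^ k + a * 2 ^ k   ∎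
    where
    open Data.Nat.Properties.≤-Reasoning
    distrib : ∀ a p q → a * (p * q + p) ≡ (a * p) * q + a * p
    distrib = solve-∀

  transform-polynomial : ∀ {a k} (s : ℕ → ℕ) → (∀ n → s n ≤ a * n ^ k + a) → ∀ d →
    ∃[ a′ ] ∃[ k′ ] (∀ n → suc ((2 + s n) ^ suc d + n) ≤ a′ * n ^ k′ + a′)
  transform-polynomial {a} {k} s s≤ d = toPolySize (bounded-+ (bounded-const 1) (bounded-+ power bounded-id))
    where
    power : BoundedBy ((2 + (a + a)) ^ suc d) (suc d * k) (λ n → (2 + s n) ^ suc d)
    power = bounded-^ (bounded-+ (bounded-const 2) (fromPolySize {a} {k} s≤)) (suc d)

module Construction {c ℓ : Level} (R : CommutativeRing c ℓ)
    (sign : CommutativeRing.Carrier R → CommutativeRing.Carrier R)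
    (sign-cong : ∀ {a b} → CommutativeRing._≈_ R a b → CommutativeRing._≈_ R (sign a) (sign b)) where

  open CommutativeRing R
    using (_≈_; 0#; 1#; +-cong; *-cong)
    renaming (Carrier to A; _+_ to _+R_; _*_ to _*R_; +-identityʳ to +R-identityʳ;
              refl to ≈-refl; reflexive to ≈-reflexive; trans to ≈-trans)
  open Circuits R sign

  true≢false : true ≢ false
  true≢false ()

  sumSel-none : ∀ {k} (vs : Vec A k) → sumSel (replicate k false) vs ≡ 0#
  sumSel-none []       = refl
  sumSel-none (_ ∷ vs) = sumSel-none vs

  prodSel-none : ∀ {k} (vs : Vec A k) → prodSel (replicate k false) vs ≡ 1#
  prodSel-none []       = refl
  prodSel-none (_ ∷ vs) = prodSel-none vs

  sgn-self : ∀ {n k} (j : Fin k) → isPred {n} (sgn j) j ≡ true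
  sgn-self j with j Fin.≟ j
  ... | yes _ = refl
  ... | no j≢j = ⊥-elim (j≢j refl)

  out-self : ∀ {n k} (j : Fin k) → isPred {n} (out j) j ≡ true
  out-self j with j Fin.≟ j
  ... | yes _ = refl
  ... | no j≢j = ⊥-elim (j≢j refl)

  sgn-zero-other : ∀ {n k} (u : Fin k) → isPred {n} (sgn zero) (suc u) ≡ false
  sgn-zero-other u with zero Fin.≟ suc u
  ... | no _ = refl

  out-zero-other : ∀ {n k} (u : Fin k) → isPred {n} (out zero) (suc u) ≡ false
  out-zero-other u with zero Fin.≟ suc u
  ... | no _ = refl

  path-lift : ∀ {n k} {C : Circuit n k} {g : Gate n k} {u w m} →
              Path C u w m → Path (g ∷ C) (suc u) (suc w) m
  path-lift here       = here
  path-lift (step e p) = step e (path-lift p)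

  path-snoc : ∀ {n k} {C : Circuit n k} {u w v m} →
              Path C u w m → edge C w v ≡ true → Path C u v (suc m)
  path-snoc here        e = step e here
  path-snoc (step e′ p) e = step e′ (path-snoc p e)

  HasArguments : ∀ {n} → Kind n → Set
  HasArguments kAdd = ⊤
  HasArguments kMul = ⊤
  HasArguments kSgn = ⊤
  HasArguments kOut = ⊤
  HasArguments _    = ⊥

  edge-target : ∀ {n k} (C : Circuit n k) {u w} → edge C u w ≡ true → HasArguments (kind C w)
  edge-target (g         ∷ C) {zero}  {zero}  ()
  edge-target (g         ∷ C) {zero}  {suc w} ()
  edge-target (g         ∷ C) {suc u} {suc w} e = edge-target C e
  edge-target (input _   ∷ C) {suc u} {zero}  ()
  edge-target (const _   ∷ C) {suc u} {zero}  ()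
  edge-target (add _     ∷ C) {suc u} {zero}  _ = tt
  edge-target (mul _     ∷ C) {suc u} {zero}  _ = tt
  edge-target (sgn _     ∷ C) {suc u} {zero}  _ = tt
  edge-target (out _     ∷ C) {suc u} {zero}  _ = tt

  edge-target-notInput : ∀ {n k} (C : Circuit n k) {u w} → edge C u w ≡ true → ¬ IsInput C w
  edge-target-notInput C e (i , kw) = subst HasArguments kw (edge-target C e)

  NonConst : ∀ {n} → Kind n → Set c
  NonConst kd = ∀ r → kd ≢ kConst r

  edge-target-nonConst : ∀ {n k} (C : Circuit n k) {u w} → edge C u w ≡ true → NonConst (kind C w)
  edge-target-nonConst C e r kw = subst HasArguments kw (edge-target C e)

  input-nonConst : ∀ {n k} (C : Circuit n k) {u} → IsInput C u → NonConst (kind C u)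
  input-nonConst C (i , ku) r ku′ with () ← trans (sym ku) ku′

  -- Over k stacked gates, selectAt k j selects the gate having exactly j gates below it.
  selectAt : (k : ℕ) → ℕ → Vec Bool k
  selectAt zero    j = []
  selectAt (suc k) j = ⌊ k ≟ j ⌋ ∷ selectAt k j

  selectAt-none : ∀ k j → k ≤ j → selectAt k j ≡ replicate k false
  selectAt-none zero    j _   = refl
  selectAt-none (suc k) j k<j with k ≟ j
  ... | yes refl = ⊥-elim (<-irrefl refl k<j)
  ... | no _     = cong (false ∷_) (selectAt-none k j (<⇒≤ k<j))

  module Formulas (n : ℕ) where

    data Formula : Set c where
      var        : Fin n → Formula
      cst        : A → Formula
      plus times : List Formula → Formula
      sgnOf      : Formula → Formula

    evalF    : (Fin n → A) → Formula → A
    evalSum  : (Fin n → A) → List Formula → A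
    evalProd : (Fin n → A) → List Formula → A
    evalF x (var i)     = x i
    evalF x (cst r)     = r
    evalF x (plus es)   = evalSum x es
    evalF x (times es)  = evalProd x es
    evalF x (sgnOf e)   = sign (evalF x e)
    evalSum x []        = 0#
    evalSum x (e ∷ es)  = evalF x e +R evalSum x es
    evalProd x []       = 1#
    evalProd x (e ∷ es) = evalF x e *R evalProd x es

    -- Constant folding.  A constant gate lies on no path from an input, so a
    -- subformula built from constants only must be folded to keep heights
    -- bounded by the depth of the circuit.
    constValue : Formula → Maybe A
    constValue (cst r)   = just r
    constValue (var _)   = nothing
    constValue (plus _)  = nothing
    constValue (times _) = nothing
    constValue (sgnOf _) = nothing

    constValues : List Formula → Maybe (List A)
    constValues []       = just []
    constValues (e ∷ es) = Maybe.zipWith _∷_ (constValue e) (constValues es)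

    constValue-sound : ∀ x e {r} → constValue e ≡ just r → evalF x e ≡ r
    constValue-sound x (cst r) refl = refl

    constValues-sum : ∀ x es {rs} → constValues es ≡ just rs → evalSum x es ≡ foldr _+R_ 0# rs
    constValues-sum x []       refl = refl
    constValues-sum x (e ∷ es) eq with constValue e in ce | constValues es in ces
    constValues-sum x (e ∷ es) refl | just r | just rs =
      cong₂ _+R_ (constValue-sound x e ce) (constValues-sum x es ces)

    constValues-prod : ∀ x es {rs} → constValues es ≡ just rs → evalProd x es ≡ foldr _*R_ 1# rs
    constValues-prod x []       refl = refl
    constValues-prod x (e ∷ es) eq with constValue e in ce | constValues es in ces
    constValues-prod x (e ∷ es) refl | just r | just rs =
      cong₂ _*R_ (constValue-sound x e ce) (constValues-prod x es ces)

    plus′ : List Formula → Formula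
    plus′ es with constValues es
    ... | just rs = cst (foldr _+R_ 0# rs)
    ... | nothing = plus es

    times′ : List Formula → Formula
    times′ es with constValues es
    ... | just rs = cst (foldr _*R_ 1# rs)
    ... | nothing = times es

    sgn′ : Formula → Formula
    sgn′ e with constValue e
    ... | just r  = cst (sign r)
    ... | nothing = sgnOf e

    plus′-sound : ∀ x es → evalF x (plus′ es) ≡ evalSum x es
    plus′-sound x es with constValues es in eq
    ... | just rs = sym (constValues-sum x es eq)
    ... | nothing = refl

    times′-sound : ∀ x es → evalF x (times′ es) ≡ evalProd x es
    times′-sound x es with constValues es in eq
    ... | just rs = sym (constValues-prod x es eq)
    ... | nothing = refl

    sgn′-sound : ∀ x e → evalF x (sgn′ e) ≡ sign (evalF x e)
    sgn′-sound x e with constValue e in eq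
    ... | just r  = sym (cong sign (constValue-sound x e eq))
    ... | nothing = refl

    plus′-kept : ∀ es → constValue (plus′ es) ≡ nothing → constValues es ≡ nothing × plus′ es ≡ plus es
    plus′-kept es nc with constValues es
    ... | nothing = refl , refl

    times′-kept : ∀ es → constValue (times′ es) ≡ nothing →
                  constValues es ≡ nothing × times′ es ≡ times es
    times′-kept es nc with constValues es
    ... | nothing = refl , refl

    sgn′-kept : ∀ e → constValue (sgn′ e) ≡ nothing → constValue e ≡ nothing × sgn′ e ≡ sgnOf e
    sgn′-kept e nc with constValue e
    ... | nothing = refl , refl

    selected : ∀ {X : Set c} {k} → Vec Bool k → Vec X k → List X
    selected []          []       = []
    selected (true  ∷ S) (e ∷ es) = e ∷ selected S es
    selected (false ∷ S) (e ∷ es) = selected S es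

    gateFormula : ∀ {k} → Gate n k → Vec Formula k → Formula
    gateFormula (input i) es = var i
    gateFormula (const r) es = cst r
    gateFormula (add S)   es = plus′ (selected S es)
    gateFormula (mul S)   es = times′ (selected S es)
    gateFormula (sgn j)   es = sgn′ (lookup es j)
    gateFormula (out j)   es = lookup es j

    formulas : ∀ {k} → Circuit n k → Vec Formula k
    formulas []      = []
    formulas (g ∷ C) = gateFormula g (formulas C) ∷ formulas C

    sum-selected : ∀ x {k} (S : Vec Bool k) (es : Vec Formula k) (vs : Vec A k) →
                   (∀ j → evalF x (lookup es j) ≈ lookup vs j) → evalSum x (selected S es) ≈ sumSel S vs
    sum-selected x []          []       []       _  = ≈-refl
    sum-selected x (true  ∷ S) (e ∷ es) (v ∷ vs) ok = +-cong (ok zero) (sum-selected x S es vs (λ j → ok (suc j)))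
    sum-selected x (false ∷ S) (e ∷ es) (v ∷ vs) ok = sum-selected x S es vs (λ j → ok (suc j))

    prod-selected : ∀ x {k} (S : Vec Bool k) (es : Vec Formula k) (vs : Vec A k) →
                    (∀ j → evalF x (lookup es j) ≈ lookup vs j) → evalProd x (selected S es) ≈ prodSel S vs
    prod-selected x []          []       []       _  = ≈-refl
    prod-selected x (true  ∷ S) (e ∷ es) (v ∷ vs) ok = *-cong (ok zero) (prod-selected x S es vs (λ j → ok (suc j)))
    prod-selected x (false ∷ S) (e ∷ es) (v ∷ vs) ok = prod-selected x S es vs (λ j → ok (suc j))

    formulas-sound : ∀ {k} (C : Circuit n k) x u → evalF x (lookup (formulas C) u) ≈ lookup (values C x) u
    formulas-sound (input i ∷ C) x zero = ≈-refl
    formulas-sound (const r ∷ C) x zero = ≈-refl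
    formulas-sound (add S ∷ C)   x zero = ≈-trans (≈-reflexive (plus′-sound x (selected S (formulas C))))
                                           (sum-selected x S (formulas C) (values C x) (formulas-sound C x))
    formulas-sound (mul S ∷ C)   x zero = ≈-trans (≈-reflexive (times′-sound x (selected S (formulas C))))
                                           (prod-selected x S (formulas C) (values C x) (formulas-sound C x))
    formulas-sound (sgn j ∷ C)   x zero = ≈-trans (≈-reflexive (sgn′-sound x (lookup (formulas C) j)))
                                           (sign-cong (formulas-sound C x j))
    formulas-sound (out j ∷ C)   x zero = formulas-sound C x j
    formulas-sound (g ∷ C)     x (suc u) = formulas-sound C x u

    height    : Formula → ℕ
    maxHeight : List Formula → ℕ
    height (var _)       = 0
    height (cst _)       = 0
    height (plus es)     = suc (maxHeight es)
    height (times es)    = suc (maxHeight es)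
    height (sgnOf e)     = suc (height e)
    maxHeight []         = 0
    maxHeight (e ∷ es)   = height e ⊔ maxHeight es

    constValue-height : ∀ e {r} → constValue e ≡ just r → height e ≡ 0
    constValue-height (cst _) refl = refl

    constValues-height : ∀ es {rs} → constValues es ≡ just rs → maxHeight es ≡ 0
    constValues-height []       refl = refl
    constValues-height (e ∷ es) eq with constValue e in ce | constValues es in ces
    constValues-height (e ∷ es) refl | just r | just rs =
      cong₂ _⊔_ (constValue-height e ce) (constValues-height es ces)

    tallest : ∀ es → constValues es ≡ nothing →
              ∃[ e ] (e ∈ es × constValue e ≡ nothing × maxHeight es ≤ height e)
    tallest (e ∷ es) nc with constValue e in ce | constValues es in ces
    tallest (e ∷ es) () | just r | just rs
    tallest (e ∷ es) nc | just r | nothing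
      with e′ , e′∈es , nc′ , es≤e′ ← tallest es ces =
      e′ , there e′∈es , nc′ , ⊔-lub (≤-trans (≤-reflexive (constValue-height e ce)) z≤n) es≤e′
    tallest (e ∷ es) nc | nothing | just rs =
      e , here refl , ce , ⊔-lub ≤-refl (≤-trans (≤-reflexive (constValues-height es ces)) z≤n)
    tallest (e ∷ es) nc | nothing | nothing
      with e′ , e′∈es , nc′ , es≤e′ ← tallest es ces | height e ≤? height e′
    ... | yes e≤e′ = e′ , there e′∈es , nc′ , ⊔-lub e≤e′ es≤e′
    ... | no  e≰e′ = e , here refl , ce , ⊔-lub ≤-refl (≤-trans es≤e′ (<⇒≤ (≰⇒> e≰e′)))

    selected-∈ : ∀ {k} {e : Formula} (S : Vec Bool k) (es : Vec Formula k) →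
                 e ∈ selected S es → ∃[ j ] (lookup S j ≡ true × lookup es j ≡ e)
    selected-∈ []          []       ()
    selected-∈ (true ∷ S)  (e ∷ es) (here refl) = zero , refl , refl
    selected-∈ (true ∷ S)  (e ∷ es) (there e∈)  with j , Sj , esj ← selected-∈ S es e∈ = suc j , Sj , esj
    selected-∈ (false ∷ S) (e ∷ es) e∈          with j , Sj , esj ← selected-∈ S es e∈ = suc j , Sj , esj

    -- The height of a non-constant gate formula is witnessed by a path from an
    -- input gate; this is what bounds heights by the depth of the circuit.
    TallPath : ∀ {k} → Circuit n k → Fin k → Set c
    TallPath C u = ∃[ w ] ∃[ m ] (IsInput C w × Path C w u m × height (lookup (formulas C) u) ≤ m)

    node-path : ∀ {k} (C : Circuit n k) (g : Gate n k) (S : Vec Bool k) →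
                (∀ j → lookup S j ≡ true → isPred g j ≡ true) →
                (∀ j → constValue (lookup (formulas C) j) ≡ nothing → TallPath C j) →
                constValues (selected S (formulas C)) ≡ nothing →
                ∃[ w ] ∃[ m ] (IsInput (g ∷ C) w × Path (g ∷ C) w zero m
                               × suc (maxHeight (selected S (formulas C))) ≤ m)
    node-path C g S pred path nc
      with e , e∈ , nce , es≤e ← tallest (selected S (formulas C)) nc
      with j , Sj , refl ← selected-∈ S (formulas C) e∈
      with w , m , w-in , p , e≤m ← path j nce =
      suc w , suc m , w-in , path-snoc (path-lift p) (pred j Sj) , s≤s (≤-trans es≤e e≤m)

    formula-path : ∀ {k} (C : Circuit n k) u → constValue (lookup (formulas C) u) ≡ nothing → TallPath C u
    formula-path (input i ∷ C) zero nc = zero , 0 , (i , refl) , here , z≤n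
    formula-path (add S ∷ C) zero nc with plus′-kept (selected S (formulas C)) nc
    ... | nc′ , kept rewrite kept = node-path C (add S) S (λ _ Sj → Sj) (formula-path C) nc′
    formula-path (mul S ∷ C) zero nc with times′-kept (selected S (formulas C)) nc
    ... | nc′ , kept rewrite kept = node-path C (mul S) S (λ _ Sj → Sj) (formula-path C) nc′
    formula-path (sgn j ∷ C) zero nc with sgn′-kept (lookup (formulas C) j) nc
    ... | nc′ , kept rewrite kept with w , m , w-in , p , h≤m ← formula-path C j nc′ =
      suc w , suc m , w-in , path-snoc (path-lift p) (sgn-self {n} j) , s≤s h≤m
    formula-path (out j ∷ C) zero nc with w , m , w-in , p , h≤m ← formula-path C j nc =
      suc w , suc m , w-in , path-snoc (path-lift p) (out-self {n} j) , ≤-trans h≤m (n≤1+n m)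
    formula-path (g ∷ C) (suc u) nc with w , m , w-in , p , h≤m ← formula-path C u nc =
      suc w , m , w-in , path-lift p , h≤m

    FanIn  : ℕ → Formula → Set
    FanIns : ℕ → List Formula → Set
    FanIn m (var _)      = ⊤
    FanIn m (cst _)      = ⊤
    FanIn m (plus es)    = length es ≤ m × FanIns m es
    FanIn m (times es)   = length es ≤ m × FanIns m es
    FanIn m (sgnOf e)    = FanIn m e
    FanIns m []          = ⊤
    FanIns m (e ∷ es)    = FanIn m e × FanIns m es

    fanIn-mono  : ∀ {m m′} → m ≤ m′ → ∀ e → FanIn m e → FanIn m′ e
    fanIns-mono : ∀ {m m′} → m ≤ m′ → ∀ es → FanIns m es → FanIns m′ es
    fanIn-mono m≤ (var _)    _        = tt
    fanIn-mono m≤ (cst _)    _        = tt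
    fanIn-mono m≤ (plus es)  (l , fs) = ≤-trans l m≤ , fanIns-mono m≤ es fs
    fanIn-mono m≤ (times es) (l , fs) = ≤-trans l m≤ , fanIns-mono m≤ es fs
    fanIn-mono m≤ (sgnOf e)  f        = fanIn-mono m≤ e f
    fanIns-mono m≤ []        _        = tt
    fanIns-mono m≤ (e ∷ es)  (f , fs) = fanIn-mono m≤ e f , fanIns-mono m≤ es fs

    selected-length : ∀ {X : Set c} {k} (S : Vec Bool k) (es : Vec X k) → length (selected S es) ≤ k
    selected-length []          []       = z≤n
    selected-length (true  ∷ S) (e ∷ es) = s≤s (selected-length S es)
    selected-length (false ∷ S) (e ∷ es) = m≤n⇒m≤1+n (selected-length S es)

    selected-fanIn : ∀ {m k} (S : Vec Bool k) (es : Vec Formula k) →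
                     (∀ j → FanIn m (lookup es j)) → FanIns m (selected S es)
    selected-fanIn []          []       _ = tt
    selected-fanIn (true  ∷ S) (e ∷ es) f = f zero , selected-fanIn S es (λ j → f (suc j))
    selected-fanIn (false ∷ S) (e ∷ es) f = selected-fanIn S es (λ j → f (suc j))

    plus′-fanIn : ∀ {m} es → length es ≤ m → FanIns m es → FanIn m (plus′ es)
    plus′-fanIn es l fs with constValues es
    ... | just _  = tt
    ... | nothing = l , fs

    times′-fanIn : ∀ {m} es → length es ≤ m → FanIns m es → FanIn m (times′ es)
    times′-fanIn es l fs with constValues es
    ... | just _  = tt
    ... | nothing = l , fs

    sgn′-fanIn : ∀ {m} e → FanIn m e → FanIn m (sgn′ e)
    sgn′-fanIn e f with constValue e
    ... | just _  = tt
    ... | nothing = f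

    formulas-fanIn  : ∀ {k} (C : Circuit n k) u → FanIn k (lookup (formulas C) u)
    formulas-fanIn↑ : ∀ {k} (C : Circuit n k) u → FanIn (suc k) (lookup (formulas C) u)
    formulas-fanIn (input i ∷ C) zero = tt
    formulas-fanIn (const r ∷ C) zero = tt
    formulas-fanIn (add S ∷ C)   zero = plus′-fanIn _ (m≤n⇒m≤1+n (selected-length S (formulas C)))
                                          (selected-fanIn S (formulas C) (formulas-fanIn↑ C))
    formulas-fanIn (mul S ∷ C)   zero = times′-fanIn _ (m≤n⇒m≤1+n (selected-length S (formulas C)))
                                          (selected-fanIn S (formulas C) (formulas-fanIn↑ C))
    formulas-fanIn (sgn j ∷ C)   zero = sgn′-fanIn (lookup (formulas C) j) (formulas-fanIn↑ C j)
    formulas-fanIn (out j ∷ C)   zero = formulas-fanIn↑ C j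
    formulas-fanIn (g ∷ C)    (suc u) = formulas-fanIn↑ C u

    formulas-fanIn↑ {k} C u = fanIn-mono (n≤1+n k) (lookup (formulas C) u) (formulas-fanIn C u)

  -- Leveled trees: Tree h is a formula whose variables all sit at depth
  -- exactly h; constants may occur at any depth.
  module Trees (n : ℕ) where
    open Formulas n

    data Tree : ℕ → Set c where
      var        : Fin n → Tree 0
      cst        : ∀ {h} → A → Tree h
      plus times : ∀ {h} → List (Tree h) → Tree (suc h)
      sgnOf      : ∀ {h} → Tree h → Tree (suc h)

    evalT : (Fin n → A) → ∀ {h} → Tree h → A
    sumT  : (Fin n → A) → ∀ {h} → List (Tree h) → A
    prodT : (Fin n → A) → ∀ {h} → List (Tree h) → A
    evalT x (var i)    = x i
    evalT x (cst r)    = r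
    evalT x (plus ts)  = sumT x ts
    evalT x (times ts) = prodT x ts
    evalT x (sgnOf t)  = sign (evalT x t)
    sumT x []          = 0#
    sumT x (t ∷ ts)    = evalT x t +R sumT x ts
    prodT x []         = 1#
    prodT x (t ∷ ts)   = evalT x t *R prodT x ts

    -- Padding a formula of height ≤ h to depth exactly h: a variable is pushed
    -- down through unary additions.  (Non-leaf formulas never meet h = 0 when
    -- their height is ≤ h; that case is filled arbitrarily.)
    pad    : (h : ℕ) → Formula → Tree h
    padAll : (h : ℕ) → List Formula → List (Tree h)
    pad h       (cst r)    = cst r
    pad zero    (var i)    = var i
    pad (suc h) (var i)    = plus (pad h (var i) ∷ [])
    pad (suc h) (plus es)  = plus (padAll h es)
    pad (suc h) (times es) = times (padAll h es)
    pad (suc h) (sgnOf e)  = sgnOf (pad h e)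
    pad zero    _          = cst 0#
    padAll h []       = []
    padAll h (e ∷ es) = pad h e ∷ padAll h es

    pad-sound     : ∀ x h e  → height e ≤ h → evalT x (pad h e) ≈ evalF x e
    padAll-sum    : ∀ x h es → maxHeight es ≤ h → sumT x (padAll h es) ≈ evalSum x es
    padAll-prod   : ∀ x h es → maxHeight es ≤ h → prodT x (padAll h es) ≈ evalProd x es
    pad-sound x h       (cst r)    _         = ≈-refl
    pad-sound x zero    (var i)    _         = ≈-refl
    pad-sound x (suc h) (var i)    _         = ≈-trans (+R-identityʳ _) (pad-sound x h (var i) z≤n)
    pad-sound x (suc h) (plus es)  (s≤s es≤) = padAll-sum x h es es≤
    pad-sound x (suc h) (times es) (s≤s es≤) = padAll-prod x h es es≤
    pad-sound x (suc h) (sgnOf e)  (s≤s e≤)  = sign-cong (pad-sound x h e e≤)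
    padAll-sum x h []       _  = ≈-refl
    padAll-sum x h (e ∷ es) ≤h =
      +-cong (pad-sound x h e (≤-trans (m≤m⊔n (height e) (maxHeight es)) ≤h))
             (padAll-sum x h es (≤-trans (m≤n⊔m (height e) (maxHeight es)) ≤h))
    padAll-prod x h []       _  = ≈-refl
    padAll-prod x h (e ∷ es) ≤h =
      *-cong (pad-sound x h e (≤-trans (m≤m⊔n (height e) (maxHeight es)) ≤h))
             (padAll-prod x h es (≤-trans (m≤n⊔m (height e) (maxHeight es)) ≤h))

    -- Gate counts of the compiled tree, starting from k gates: treeSize counts
    -- all gates of t, belowRoot all but its root.
    treeSize   : ∀ {h} → Tree h → ℕ → ℕ
    belowRoot  : ∀ {h} → Tree h → ℕ → ℕ
    forestSize : ∀ {h} → List (Tree h) → ℕ → ℕ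
    treeSize t k = suc (belowRoot t k)
    belowRoot (var _)    k = k
    belowRoot (cst _)    k = k
    belowRoot (plus ts)  k = forestSize ts k
    belowRoot (times ts) k = forestSize ts k
    belowRoot (sgnOf t)  k = treeSize t k
    forestSize []       k = k
    forestSize (t ∷ ts) k = treeSize t (forestSize ts k)

    -- One level of a tree with fan-in ≤ m multiplies the size bound by 2 + m.
    nary-step : ∀ m X l → l ≤ m → 1 ≤ X → suc (l * X) ≤ (2 + m) * X
    nary-step m X l l≤m 1≤X = ≤-trans (+-mono-≤ 1≤X (*-monoˡ-≤ X l≤m)) (+-monoʳ-≤ X (m≤n+m (m * X) X))

    unary-step : ∀ m X Y k → Y ≤ X + k → 1 ≤ X → suc Y ≤ (2 + m) * X + k
    unary-step m X Y k Y≤ 1≤X = ≤-trans (s≤s Y≤) (+-monoˡ-≤ k (+-mono-≤ 1≤X (m≤m+n X (m * X))))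

    pad-size    : ∀ m h e k → FanIn m e → treeSize (pad h e) k ≤ (2 + m) ^ suc h + k
    padAll-size : ∀ m h es k → FanIns m es → forestSize (padAll h es) k ≤ length es * (2 + m) ^ suc h + k
    pad-size m h       (cst r)    k _ = +-monoˡ-≤ k (m^n>0 (2 + m) (suc h))
    pad-size m zero    (var i)    k _ = +-monoˡ-≤ k (m^n>0 (2 + m) 1)
    pad-size m (suc h) (var i)    k f = unary-step m _ _ k (pad-size m h (var i) k f) (m^n>0 (2 + m) (suc h))
    pad-size m (suc h) (plus es)  k (l , fs) =
      ≤-trans (s≤s (padAll-size m h es k fs)) (+-monoˡ-≤ k (nary-step m _ _ l (m^n>0 (2 + m) (suc h))))
    pad-size m (suc h) (times es) k (l , fs) =
      ≤-trans (s≤s (padAll-size m h es k fs)) (+-monoˡ-≤ k (nary-step m _ _ l (m^n>0 (2 + m) (suc h))))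
    pad-size m (suc h) (sgnOf e)  k f = unary-step m _ _ k (pad-size m h e k f) (m^n>0 (2 + m) (suc h))
    pad-size m zero    (plus _)   k _ = +-monoˡ-≤ k (m^n>0 (2 + m) 1)
    pad-size m zero    (times _)  k _ = +-monoˡ-≤ k (m^n>0 (2 + m) 1)
    pad-size m zero    (sgnOf _)  k _ = +-monoˡ-≤ k (m^n>0 (2 + m) 1)
    padAll-size m h []       k _        = ≤-refl
    padAll-size m h (e ∷ es) k (f , fs) =
      ≤-trans (pad-size m h e _ f)
        (≤-trans (+-monoʳ-≤ ((2 + m) ^ suc h) (padAll-size m h es k fs))
                 (≤-reflexive (sym (+-assoc ((2 + m) ^ suc h) _ k))))

  module Compilation (n : ℕ) where
    open Trees n

    -- Vectors indexed by the gates created when compiling: every new gate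
    -- rooting a subtree of height j gets the label f j, except the roots of a
    -- compiled forest, which get x; the old gates keep their labels V.
    labelBelow  : ∀ {X : Set} {h k} → (ℕ → X) → (t : Tree h) → Vec X k → Vec X (belowRoot t k)
    labelForest : ∀ {X : Set} {h k} → X → (ℕ → X) → (ts : List (Tree h)) → Vec X k → Vec X (forestSize ts k)
    labelBelow f (var _)               V = V
    labelBelow f (cst _)               V = V
    labelBelow {h = suc h} f (plus ts)  V = labelForest (f h) f ts V
    labelBelow {h = suc h} f (times ts) V = labelForest (f h) f ts V
    labelBelow {h = suc h} f (sgnOf t)  V = f h ∷ labelBelow f t V
    labelForest x f []       V = V
    labelForest x f (t ∷ ts) V = x ∷ labelBelow f t (labelForest x f ts V)

    zipWith-labelBelow : ∀ {X Y Z : Set} {h k} (g : X → Y → Z) f₁ f₂ (t : Tree h) (V₁ : Vec X k) V₂ →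
      zipWith g (labelBelow f₁ t V₁) (labelBelow f₂ t V₂)
        ≡ labelBelow (λ j → g (f₁ j) (f₂ j)) t (zipWith g V₁ V₂)
    zipWith-labelForest : ∀ {X Y Z : Set} {h k} (g : X → Y → Z) x₁ x₂ f₁ f₂
                          (ts : List (Tree h)) (V₁ : Vec X k) V₂ →
      zipWith g (labelForest x₁ f₁ ts V₁) (labelForest x₂ f₂ ts V₂)
        ≡ labelForest (g x₁ x₂) (λ j → g (f₁ j) (f₂ j)) ts (zipWith g V₁ V₂)
    zipWith-labelBelow g f₁ f₂ (var _)    V₁ V₂ = refl
    zipWith-labelBelow g f₁ f₂ (cst _)    V₁ V₂ = refl
    zipWith-labelBelow {h = suc h} g f₁ f₂ (plus ts)  V₁ V₂ = zipWith-labelForest g (f₁ h) (f₂ h) f₁ f₂ ts V₁ V₂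
    zipWith-labelBelow {h = suc h} g f₁ f₂ (times ts) V₁ V₂ = zipWith-labelForest g (f₁ h) (f₂ h) f₁ f₂ ts V₁ V₂
    zipWith-labelBelow {h = suc h} g f₁ f₂ (sgnOf t)  V₁ V₂ =
      cong (g (f₁ h) (f₂ h) ∷_) (zipWith-labelBelow g f₁ f₂ t V₁ V₂)
    zipWith-labelForest g x₁ x₂ f₁ f₂ []       V₁ V₂ = refl
    zipWith-labelForest g x₁ x₂ f₁ f₂ (t ∷ ts) V₁ V₂ = cong (g x₁ x₂ ∷_)
      (trans (zipWith-labelBelow g f₁ f₂ t _ _)
             (cong (labelBelow _ t) (zipWith-labelForest g x₁ x₂ f₁ f₂ ts V₁ V₂)))

    labelBelow-replicate  : ∀ {X : Set} {h k} (z : X) (t : Tree h) →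
                            labelBelow (λ _ → z) t (replicate k z) ≡ replicate (belowRoot t k) z
    labelForest-replicate : ∀ {X : Set} {h k} (z : X) (ts : List (Tree h)) →
                            labelForest z (λ _ → z) ts (replicate k z) ≡ replicate (forestSize ts k) z
    labelBelow-replicate z (var _)    = refl
    labelBelow-replicate z (cst _)    = refl
    labelBelow-replicate z (plus ts)  = labelForest-replicate z ts
    labelBelow-replicate z (times ts) = labelForest-replicate z ts
    labelBelow-replicate z (sgnOf t)  = cong (z ∷_) (labelBelow-replicate z t)
    labelForest-replicate z []       = refl
    labelForest-replicate z (t ∷ ts) =
      cong (z ∷_) (trans (cong (labelBelow (λ _ → z) t) (labelForest-replicate z ts)) (labelBelow-replicate z t))

    zipWith-replicate-false : ∀ {Y : Set} {k} (g : Bool → Y → Y) → (∀ y → g false y ≡ y) →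
                              (V : Vec Y k) → zipWith g (replicate k false) V ≡ V
    zipWith-replicate-false g id-false []      = refl
    zipWith-replicate-false g id-false (y ∷ V) = cong₂ _∷_ (id-false y) (zipWith-replicate-false g id-false V)

    marks : ∀ {h k} → Bool → (ts : List (Tree h)) → Vec Bool k → Vec Bool (forestSize ts k)
    marks b = labelForest b (λ _ → false)

    rootMarks : ∀ {h} (ts : List (Tree h)) k → Vec Bool (forestSize ts k)
    rootMarks ts k = marks true ts (replicate k false)

    with-rootMarks : ∀ {Y : Set} (g : Bool → Y → Y) → (∀ y → g false y ≡ y) →
      ∀ {h k} (ts : List (Tree h)) (x : Y) f (V : Vec Y k) u →
      g (lookup (rootMarks ts k) u) (lookup (labelForest x f ts V) u)
        ≡ lookup (labelForest (g true x) (λ j → g false (f j)) ts V) u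
    with-rootMarks g id-false {k = k} ts x f V u = begin
        g (lookup (rootMarks ts k) u) (lookup (labelForest x f ts V) u)
      ≡⟨ sym (lookup-zipWith g u (rootMarks ts k) (labelForest x f ts V)) ⟩
        lookup (zipWith g (rootMarks ts k) (labelForest x f ts V)) u
      ≡⟨ cong (λ W → lookup W u) (zipWith-labelForest g true x (λ _ → false) f ts (replicate k false) V) ⟩
        lookup (labelForest (g true x) (λ j → g false (f j)) ts (zipWith g (replicate k false) V)) u
      ≡⟨ cong (λ W → lookup (labelForest (g true x) (λ j → g false (f j)) ts W) u)
              (zipWith-replicate-false g id-false V) ⟩
        lookup (labelForest (g true x) (λ j → g false (f j)) ts V) u
      ∎
      where open ≡-Reasoning

    -- The arguments of a parent node are pending before the parent is added,
    -- and adding the parent stops exactly them from pending.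
    rootMarks⊆marks : ∀ {h k} (ts : List (Tree h)) (P : Vec Bool k) u →
                      lookup (rootMarks ts k) u ≡ true → lookup (marks true ts P) u ≡ true
    rootMarks⊆marks ts P u root = trans (sym (with-rootMarks _∨_ (λ _ → refl) ts false (λ _ → false) P u))
                                        (cong (_∨ lookup (marks false ts P) u) root)

    marks-unroot : ∀ {h k} (ts : List (Tree h)) (P : Vec Bool k) u →
                   lookup (marks false ts P) u ≡ not (lookup (rootMarks ts k) u) ∧ lookup (marks true ts P) u
    marks-unroot ts P u = sym (with-rootMarks (λ s p → not s ∧ p) (λ _ → refl) ts true (λ _ → false) P u)

    -- The root gate of t, placed on top of the gates of its subtrees.  A
    -- variable leaf x_i becomes a unary addition of the input gate of x_i,
    -- which has toℕ i gates below it.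
    rootGate : ∀ {h k} (t : Tree h) → Gate n (belowRoot t k)
    rootGate {k = k} (var i)    = add (selectAt k (toℕ i))
    rootGate         (cst r)    = const r
    rootGate {k = k} (plus ts)  = add (rootMarks ts k)
    rootGate {k = k} (times ts) = mul (rootMarks ts k)
    rootGate         (sgnOf t)  = sgn zero

    compile       : ∀ {h k} (t : Tree h) → Circuit n k → Circuit n (treeSize t k)
    compileBelow  : ∀ {h k} (t : Tree h) → Circuit n k → Circuit n (belowRoot t k)
    compileForest : ∀ {h k} (ts : List (Tree h)) → Circuit n k → Circuit n (forestSize ts k)
    compile t D = rootGate t ∷ compileBelow t D
    compileBelow (var _)    D = D
    compileBelow (cst _)    D = D
    compileBelow (plus ts)  D = compileForest ts D
    compileBelow (times ts) D = compileForest ts D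
    compileBelow (sgnOf t)  D = compile t D
    compileForest []       D = D
    compileForest (t ∷ ts) D = compile t (compileForest ts D)

    rootGate-notInput : ∀ {h k} (t : Tree h) i → gateKind (rootGate {k = k} t) ≢ kInput i
    rootGate-notInput (var _)   i ()
    rootGate-notInput (cst _)   i ()
    rootGate-notInput (plus _)  i ()
    rootGate-notInput (times _) i ()
    rootGate-notInput (sgnOf _) i ()

    rootGate-notOutput : ∀ {h k} (t : Tree h) → gateKind (rootGate {k = k} t) ≢ kOut
    rootGate-notOutput (var _)   ()
    rootGate-notOutput (cst _)   ()
    rootGate-notOutput (plus _)  ()
    rootGate-notOutput (times _) ()
    rootGate-notOutput (sgnOf _) ()

    module _ {p : Level} (Inv : ∀ {k} → Circuit n k → Set p)
             (push : ∀ {h k} (t : Tree h) {D : Circuit n (belowRoot t k)} →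
                     Inv D → Inv (rootGate {k = k} t ∷ D)) where
      compile-preserves       : ∀ {h k} (t : Tree h) {D : Circuit n k} → Inv D → Inv (compile t D)
      compileBelow-preserves  : ∀ {h k} (t : Tree h) {D : Circuit n k} → Inv D → Inv (compileBelow t D)
      compileForest-preserves : ∀ {h k} (ts : List (Tree h)) {D : Circuit n k} → Inv D → Inv (compileForest ts D)
      compile-preserves t inv = push t (compileBelow-preserves t inv)
      compileBelow-preserves (var _)    inv = inv
      compileBelow-preserves (cst _)    inv = inv
      compileBelow-preserves (plus ts)  inv = compileForest-preserves ts inv
      compileBelow-preserves (times ts) inv = compileForest-preserves ts inv
      compileBelow-preserves (sgnOf t)  inv = compile-preserves t inv
      compileForest-preserves []       inv = inv
      compileForest-preserves (t ∷ ts) inv = compile-preserves t (compileForest-preserves ts inv)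

    inputsOK-push : ∀ {k} {D : Circuit n k} → InputsOK D → (g : Gate n k) →
                    (∀ i → gateKind g ≢ kInput i) → InputsOK (g ∷ D)
    inputsOK-push ok g notInput i with u , ku , unique ← ok i =
      suc u , ku , λ { zero k0 → ⊥-elim (notInput i k0) ; (suc u′) ku′ → cong suc (unique u′ ku′) }

    NoOutput : ∀ {k} → Circuit n k → Set c
    NoOutput D = ∀ u → ¬ IsOutput D u

    noOutput-push : ∀ {h k} (t : Tree h) {D : Circuit n (belowRoot t k)} →
                    NoOutput D → NoOutput (rootGate {k = k} t ∷ D)
    noOutput-push t none zero    = rootGate-notOutput t
    noOutput-push t none (suc u) = none u

    record InputLayer {k} (D : Circuit n k) : Set (c Level.⊔ ℓ) where
      field
        wide     : n ≤ k
        selInput : ∀ (i : Fin n) u → lookup (selectAt k (toℕ i)) u ≡ true → IsInput D u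
        selValue : ∀ (i : Fin n) x → sumSel (selectAt k (toℕ i)) (values D x) ≈ x i

    inputLayer-push : ∀ {k} {D : Circuit n k} → InputLayer D → (g : Gate n k) → InputLayer (g ∷ D)
    inputLayer-push {k} {D} layer g = record
      { wide = m≤n⇒m≤1+n wide ; selInput = selInput′ ; selValue = selValue′ }
      where
      open InputLayer layer
      above : ∀ (i : Fin n) → k ≢ toℕ i
      above i k≡i = <-irrefl (sym k≡i) (≤-trans (toℕ<n i) wide)
      selInput′ : ∀ (i : Fin n) u → lookup (selectAt (suc k) (toℕ i)) u ≡ true → IsInput (g ∷ D) u
      selInput′ i (suc u) sel = selInput i u sel
      selInput′ i zero    sel with k ≟ toℕ i
      selInput′ i zero    _  | yes k≡i = ⊥-elim (above i k≡i)
      selInput′ i zero    () | no _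
      selValue′ : ∀ (i : Fin n) x → sumSel (selectAt (suc k) (toℕ i)) (values (g ∷ D) x) ≈ x i
      selValue′ i x with k ≟ toℕ i
      ... | yes k≡i = ⊥-elim (above i k≡i)
      ... | no  _   = selValue i x

    compileForest-inputLayer : ∀ {h k} (ts : List (Tree h)) {D : Circuit n k} →
                               InputLayer D → InputLayer (compileForest ts D)
    compileForest-inputLayer = compileForest-preserves InputLayer (λ t layer → inputLayer-push layer (rootGate t))

    -- Tree-likeness, maintained while stacking gates: P marks the gates still
    -- waiting for their successor; a marked non-input gate has no successor
    -- yet, an unmarked one has exactly one.
    NoSuccessor : ∀ {k} → Circuit n k → Fin k → Set
    NoSuccessor D u = ∀ w → ¬ (edge D u w ≡ true)

    OneSuccessor : ∀ {k} → Circuit n k → Fin k → Set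
    OneSuccessor {k} D u = ∃[ w ] (edge D u w ≡ true × ((w′ : Fin k) → edge D u w′ ≡ true → w′ ≡ w))

    Pending : ∀ {k} → Circuit n k → Vec Bool k → Set c
    Pending D P = ∀ u → ¬ IsInput D u →
      (lookup P u ≡ true → NoSuccessor D u) × (lookup P u ≡ false → OneSuccessor D u)

    -- A new gate g must take its predecessors among the pending gates; those
    -- stop pending (Q = P minus the predecessors), and g itself pends.
    pending-push : ∀ {k} {D : Circuit n k} {P : Vec Bool k} (g : Gate n k) (Q : Vec Bool k) → Pending D P →
      (∀ u → ¬ IsInput D u → isPred g u ≡ true → lookup P u ≡ true) →
      (∀ u → ¬ IsInput D u → lookup Q u ≡ not (isPred g u) ∧ lookup P u) →
      Pending (g ∷ D) (true ∷ Q)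
    pending-push g Q pend wasPending update zero notIn = (λ _ → λ { zero () ; (suc _) () }) , λ ()
    pending-push {D = D} {P} g Q pend wasPending update (suc u) notIn
      with lookup P u in Pu | isPred g u in gu | lookup Q u | update u notIn | pend u notIn
    ... | true  | true  | .false | refl | none , _ = (λ ()) , λ _ → zero , gu , onlyNew
      where
      onlyNew : ∀ w′ → edge (g ∷ D) (suc u) w′ ≡ true → w′ ≡ zero
      onlyNew zero     _ = refl
      onlyNew (suc w′) e = ⊥-elim (none refl w′ e)
    ... | true  | false | .true  | refl | none , _ =
      (λ _ → λ { zero e → true≢false (trans (sym e) gu) ; (suc w) e → none refl w e }) , λ ()
    ... | false | true  | _      | _    | _ = ⊥-elim (true≢false (trans (sym (wasPending u notIn gu)) Pu))
    ... | false | false | .false | refl | _ , one with w , e , unique ← one refl =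
      (λ ()) , λ _ → suc w , e , λ { zero e′    → ⊥-elim (true≢false (trans (sym e′) gu))
                                    ; (suc w′) e′ → cong suc (unique w′ e′) }

    compile-pending : ∀ {h k} (t : Tree h) {D : Circuit n k} {P : Vec Bool k} → Pending D P → InputLayer D →
                      Pending (compile t D) (true ∷ labelBelow (λ _ → false) t P)
    compileForest-pending : ∀ {h k} (ts : List (Tree h)) {D : Circuit n k} {P : Vec Bool k} → Pending D P →
                            InputLayer D → Pending (compileForest ts D) (marks true ts P)
    compile-pending {k = k} (var i) {D} {P} pend layer = pending-push {P = P} _ P pend fromInput unchanged
      where
      open InputLayer layer
      fromInput : ∀ u → ¬ IsInput D u → lookup (selectAt k (toℕ i)) u ≡ true → lookup P u ≡ true
      fromInput u notIn sel = ⊥-elim (notIn (selInput i u sel))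
      unchanged : ∀ u → ¬ IsInput D u → lookup P u ≡ not (lookup (selectAt k (toℕ i)) u) ∧ lookup P u
      unchanged u notIn with lookup (selectAt k (toℕ i)) u in sel
      ... | true  = ⊥-elim (notIn (selInput i u sel))
      ... | false = refl
    compile-pending (cst r) {P = P} pend layer = pending-push {P = P} _ P pend (λ _ _ ()) (λ _ _ → refl)
    compile-pending (plus ts) {P = P} pend layer =
      pending-push {P = marks true ts P} _ _ (compileForest-pending ts {P = P} pend layer)
                   (λ u _ → rootMarks⊆marks ts P u) (λ u _ → marks-unroot ts P u)
    compile-pending (times ts) {P = P} pend layer =
      pending-push {P = marks true ts P} _ _ (compileForest-pending ts {P = P} pend layer)
                   (λ u _ → rootMarks⊆marks ts P u) (λ u _ → marks-unroot ts P u)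
    compile-pending {k = k} (sgnOf t) {D} {P} pend layer =
      pending-push {P = P′} _ _ (compile-pending t {P = P} pend layer) argument update
      where
      P′ : Vec Bool (treeSize t k)
      P′ = true ∷ labelBelow (λ _ → false) t P
      argument : ∀ u → ¬ IsInput (compile t D) u → isPred {n} (sgn zero) u ≡ true → lookup P′ u ≡ true
      argument zero    _ _ = refl
      argument (suc u) _ e = ⊥-elim (true≢false (trans (sym e) (sgn-zero-other {n} u)))
      update : ∀ u → ¬ IsInput (compile t D) u →
               lookup (false ∷ labelBelow (λ _ → false) t P) u ≡ not (isPred {n} (sgn zero) u) ∧ lookup P′ u
      update zero    _ rewrite sgn-self {n} {treeSize t k} zero = refl
      update (suc u) _ rewrite sgn-zero-other {n} u = refl
    compileForest-pending []       pend layer = pend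
    compileForest-pending (t ∷ ts) {P = P} pend layer =
      compile-pending t {P = marks true ts P} (compileForest-pending ts {P = P} pend layer)
                      (compileForest-inputLayer ts layer)

    record Levels {k} (D : Circuit n k) (L : Vec ℕ k) : Set c where
      field
        edge-up    : ∀ u w → edge D u w ≡ true → NonConst (kind D u) → lookup L w ≡ suc (lookup L u)
        input-zero : ∀ u → IsInput D u → lookup L u ≡ 0

    levels-push : ∀ {k} {D : Circuit n k} {L : Vec ℕ k} (g : Gate n k) (l : ℕ) → Levels D L →
                  (∀ i → gateKind g ≢ kInput i) →
                  (∀ u → isPred g u ≡ true → NonConst (kind D u) → suc (lookup L u) ≡ l) →
                  Levels (g ∷ D) (l ∷ L)
    levels-push {D = D} {L} g l lev notInput below = record { edge-up = edge-up′ ; input-zero = input-zero′ }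
      where
      open Levels lev
      edge-up′ : ∀ u w → edge (g ∷ D) u w ≡ true → NonConst (kind (g ∷ D) u) →
                 lookup (l ∷ L) w ≡ suc (lookup (l ∷ L) u)
      edge-up′ zero    zero    ()
      edge-up′ zero    (suc w) ()
      edge-up′ (suc u) zero    e nc = sym (below u e nc)
      edge-up′ (suc u) (suc w) e nc = edge-up u w e nc
      input-zero′ : ∀ u → IsInput (g ∷ D) u → lookup (l ∷ L) u ≡ 0
      input-zero′ zero    (i , gi) = ⊥-elim (notInput i gi)
      input-zero′ (suc u) inp      = input-zero u inp

    rootMarks-level : ∀ {h k} (ts : List (Tree h)) (L : Vec ℕ k) u →
                      lookup (rootMarks ts k) u ≡ true → lookup (labelForest (suc h) suc ts L) u ≡ suc h
    rootMarks-level {h} ts L u root =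
      trans (sym (with-rootMarks (λ b l → if b then suc h else l) (λ _ → refl) ts (suc h) suc L u))
            (cong (λ b → if b then suc h else lookup (labelForest (suc h) suc ts L) u) root)

    compile-levels : ∀ {h k} (t : Tree h) {D : Circuit n k} {L : Vec ℕ k} → Levels D L → InputLayer D →
                     Levels (compile t D) (suc h ∷ labelBelow suc t L)
    compileForest-levels : ∀ {h k} (ts : List (Tree h)) {D : Circuit n k} {L : Vec ℕ k} → Levels D L →
                           InputLayer D → Levels (compileForest ts D) (labelForest (suc h) suc ts L)
    compile-levels {k = k} (var i) {L = L} lev layer =
      levels-push {L = L} _ 1 lev (rootGate-notInput {k = k} (var i))
        (λ u sel _ → cong suc (Levels.input-zero lev u (InputLayer.selInput layer i u sel)))
    compile-levels {h} {k} (cst r) {L = L} lev layer =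
      levels-push {L = L} _ _ lev (rootGate-notInput {h} {k} (cst r)) (λ _ ())
    compile-levels {k = k} (plus ts) {L = L} lev layer =
      levels-push {L = labelForest _ suc ts L} _ _ (compileForest-levels ts lev layer)
        (rootGate-notInput {k = k} (plus ts)) (λ u root _ → cong suc (rootMarks-level ts L u root))
    compile-levels {k = k} (times ts) {L = L} lev layer =
      levels-push {L = labelForest _ suc ts L} _ _ (compileForest-levels ts lev layer)
        (rootGate-notInput {k = k} (times ts)) (λ u root _ → cong suc (rootMarks-level ts L u root))
    compile-levels {suc h} {k} (sgnOf t) {D} {L} lev layer =
      levels-push {L = L′} _ _ (compile-levels t lev layer) (rootGate-notInput {k = k} (sgnOf t)) argument
      where
      L′ : Vec ℕ (treeSize t k)
      L′ = suc h ∷ labelBelow suc t L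
      argument : ∀ u → isPred {n} (sgn zero) u ≡ true → NonConst (kind (compile t D) u) →
                 suc (lookup L′ u) ≡ suc (suc h)
      argument zero    _ _ = refl
      argument (suc u) e _ = ⊥-elim (true≢false (trans (sym e) (sgn-zero-other {n} u)))
    compileForest-levels []       lev layer = lev
    compileForest-levels (t ∷ ts) lev layer =
      compile-levels t (compileForest-levels ts lev layer) (compileForest-inputLayer ts layer)

    -- Semantics: the gates added below a root are never selected by gates
    -- underneath, so sums and products over old gates are unaffected.
    module Unselected (Sel : ∀ {k} → Vec Bool k → Vec A k → A)
                      (skip : ∀ {k} (B : Vec Bool k) v vs → Sel (false ∷ B) (v ∷ vs) ≡ Sel B vs) where
      compileBelow-unselected  : ∀ {h k} (t : Tree h) {D : Circuit n k} B x →
        Sel (labelBelow (λ _ → false) t B) (values (compileBelow t D) x) ≡ Sel B (values D x)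
      compileForest-unselected : ∀ {h k} (ts : List (Tree h)) {D : Circuit n k} B x →
        Sel (marks false ts B) (values (compileForest ts D) x) ≡ Sel B (values D x)
      compileBelow-unselected (var _)    B x = refl
      compileBelow-unselected (cst _)    B x = refl
      compileBelow-unselected (plus ts)  B x = compileForest-unselected ts B x
      compileBelow-unselected (times ts) B x = compileForest-unselected ts B x
      compileBelow-unselected (sgnOf t)  B x = trans (skip _ _ _) (compileBelow-unselected t B x)
      compileForest-unselected []       B x = refl
      compileForest-unselected (t ∷ ts) B x =
        trans (skip _ _ _) (trans (compileBelow-unselected t _ x) (compileForest-unselected ts B x))

    open Unselected sumSel  (λ _ _ _ → refl) renaming (compileBelow-unselected to sum-unselected)
    open Unselected prodSel (λ _ _ _ → refl) renaming (compileBelow-unselected to prod-unselected)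

    compile-sound  : ∀ {h k} (t : Tree h) {D : Circuit n k} → InputLayer D → ∀ x →
                     lookup (values (compile t D) x) zero ≈ evalT x t
    compileForest-sum  : ∀ {h k} (ts : List (Tree h)) {D : Circuit n k} → InputLayer D → ∀ x →
                         sumSel (rootMarks ts k) (values (compileForest ts D) x) ≈ sumT x ts
    compileForest-prod : ∀ {h k} (ts : List (Tree h)) {D : Circuit n k} → InputLayer D → ∀ x →
                         prodSel (rootMarks ts k) (values (compileForest ts D) x) ≈ prodT x ts
    compile-sound (var i)    layer x = InputLayer.selValue layer i x
    compile-sound (cst r)    layer x = ≈-refl
    compile-sound (plus ts)  layer x = compileForest-sum ts layer x
    compile-sound (times ts) layer x = compileForest-prod ts layer x
    compile-sound (sgnOf t)  layer x = sign-cong (compile-sound t layer x)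
    compileForest-sum []       {D} layer x = ≈-reflexive (sumSel-none (values D x))
    compileForest-sum (t ∷ ts) layer x =
      +-cong (compile-sound t (compileForest-inputLayer ts layer) x)
             (≈-trans (≈-reflexive (sum-unselected t _ x)) (compileForest-sum ts layer x))
    compileForest-prod []       {D} layer x = ≈-reflexive (prodSel-none (values D x))
    compileForest-prod (t ∷ ts) layer x =
      *-cong (compile-sound t (compileForest-inputLayer ts layer) x)
             (≈-trans (≈-reflexive (prod-unselected t _ x)) (compileForest-prod ts layer x))

    path-level : ∀ {k} {D : Circuit n k} {L : Vec ℕ k} → Levels D L → ∀ {u v m} →
                 Path D u v m → NonConst (kind D u) → lookup L v ≡ lookup L u + m
    path-level lev here _ = sym (+-identityʳ _)
    path-level {D = D} {L} lev {u} (step {w = w} {k = m} e p) nc = begin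
        lookup L _                ≡⟨ path-level lev p (edge-target-nonConst D e) ⟩
        lookup L w + m            ≡⟨ cong (_+ m) (Levels.edge-up lev u w e nc) ⟩
        suc (lookup L u) + m      ≡⟨ sym (+-suc (lookup L u) m) ⟩
        lookup L u + suc m        ∎
      where open ≡-Reasoning

    -- The input layer: the gate holding x_j has exactly j gates below it.
    inputs : (m : ℕ) → m ≤ n → Circuit n m
    inputs zero    _   = []
    inputs (suc m) m<n = input (fromℕ< m<n) ∷ inputs m (<⇒≤ m<n)

    inputs-input : ∀ m (m≤n : m ≤ n) u → IsInput (inputs m m≤n) u
    inputs-input (suc m) m<n zero    = fromℕ< m<n , refl
    inputs-input (suc m) m<n (suc u) = inputs-input m (<⇒≤ m<n) u

    inputs-below : ∀ m (m≤n : m ≤ n) u (i : Fin n) → kind (inputs m m≤n) u ≡ kInput i → toℕ i < m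
    inputs-below (suc m) m<n zero    i refl = s≤s (≤-reflexive (toℕ-fromℕ< m<n))
    inputs-below (suc m) m<n (suc u) i ku   = m≤n⇒m≤1+n (inputs-below m (<⇒≤ m<n) u i ku)

    inputs-unique : ∀ m (m≤n : m ≤ n) (i : Fin n) → toℕ i < m →
      ∃[ u ] (kind (inputs m m≤n) u ≡ kInput i
              × ((u′ : Fin m) → kind (inputs m m≤n) u′ ≡ kInput i → u′ ≡ u))
    inputs-unique (suc m) m<n i i<1+m with toℕ i ≟ m
    ... | yes i≡m = zero , cong kInput (toℕ-injective (trans (toℕ-fromℕ< m<n) (sym i≡m))) , only
      where
      only : ∀ u′ → kind (inputs (suc m) m<n) u′ ≡ kInput i → u′ ≡ zero
      only zero     _   = refl
      only (suc u′) ku′ = ⊥-elim (<-irrefl i≡m (inputs-below m (<⇒≤ m<n) u′ i ku′))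
    ... | no i≢m with u , ku , unique ← inputs-unique m (<⇒≤ m<n) i (≤∧≢⇒< (≤-pred i<1+m) i≢m) =
      suc u , ku , only
      where
      only : ∀ u′ → kind (inputs (suc m) m<n) u′ ≡ kInput i → u′ ≡ suc u
      only zero     refl = ⊥-elim (i≢m (toℕ-fromℕ< m<n))
      only (suc u′) ku′  = cong suc (unique u′ ku′)

    inputs-value : ∀ m (m≤n : m ≤ n) (i : Fin n) → toℕ i < m → ∀ x →
                   sumSel (selectAt m (toℕ i)) (values (inputs m m≤n) x) ≈ x i
    inputs-value (suc m) m<n i i<1+m x with m ≟ toℕ i
    ... | yes refl = ≈-trans (+-cong (≈-reflexive (cong x (toℕ-injective (toℕ-fromℕ< m<n)))) nothing-else)
                             (+R-identityʳ (x i))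
      where
      nothing-else : sumSel (selectAt m m) (values (inputs m (<⇒≤ m<n)) x) ≈ 0#
      nothing-else = ≈-reflexive (trans (cong (λ S → sumSel S (values (inputs m (<⇒≤ m<n)) x))
                                              (selectAt-none m m ≤-refl))
                                        (sumSel-none (values (inputs m (<⇒≤ m<n)) x)))
    ... | no m≢i = inputs-value m (<⇒≤ m<n) i (≤∧≢⇒< (≤-pred i<1+m) (λ i≡m → m≢i (sym i≡m))) x

    base : Circuit n n
    base = inputs n ≤-refl

    base-layer : InputLayer base
    base-layer = record
      { wide = ≤-refl
      ; selInput = λ _ u _ → inputs-input n ≤-refl u
      ; selValue = λ i x → inputs-value n ≤-refl i (toℕ<n i) x }

    base-inputsOK : InputsOK base
    base-inputsOK i = inputs-unique n ≤-refl i (toℕ<n i)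

    base-noOutput : NoOutput base
    base-noOutput u isOut with i , ku ← inputs-input n ≤-refl u with () ← trans (sym isOut) ku

    base-pending : Pending base (replicate n false)
    base-pending u notIn = ⊥-elim (notIn (inputs-input n ≤-refl u))

    base-levels : Levels base (replicate n 0)
    base-levels = record
      { edge-up    = λ u w e _ → ⊥-elim (edge-target-notInput base e (inputs-input n ≤-refl w))
      ; input-zero = λ u _ → lookup-replicate u 0 }

    module Compiled {h : ℕ} (t : Tree h) where
      body : Circuit n (treeSize t n)
      body = compile t base

      circuit : Circuit n (suc (treeSize t n))
      circuit = out zero ∷ body

      body-noOutput : NoOutput body
      body-noOutput = compile-preserves NoOutput noOutput-push t base-noOutput

      body-inputsOK : InputsOK body
      body-inputsOK = compile-preserves InputsOK (λ t ok → inputsOK-push ok (rootGate t) (rootGate-notInput t))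
                                        t base-inputsOK

      soCircuit : SOCircuit n
      soCircuit = record
        { size      = suc (treeSize t n)
        ; circ      = circuit
        ; inputsOK  = inputsOK-push body-inputsOK (out zero) (λ _ ())
        ; output    = zero
        ; outputOK  = refl
        ; outputUnq = λ { zero _ → refl ; (suc u) o → ⊥-elim (body-noOutput u o) } }

      sound : ∀ x → fun soCircuit x ≈ evalT x t
      sound = compile-sound t base-layer

      -- The output gate consumes the root; afterwards only the output pends.
      pending : Pending circuit (true ∷ replicate (treeSize t n) false)
      pending = pending-push {P = P} (out zero) (replicate _ false) (compile-pending t base-pending base-layer)
                             argument update
        where
        P : Vec Bool (treeSize t n)
        P = true ∷ labelBelow (λ _ → false) t (replicate n false)
        argument : ∀ u → ¬ IsInput body u → isPred {n} (out zero) u ≡ true → lookup P u ≡ true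
        argument zero    _ _ = refl
        argument (suc u) _ e = ⊥-elim (true≢false (trans (sym e) (out-zero-other {n} u)))
        update : ∀ u → ¬ IsInput body u →
                 lookup (replicate (treeSize t n) false) u ≡ not (isPred {n} (out zero) u) ∧ lookup P u
        update zero    _ rewrite out-self {n} {treeSize t n} zero = refl
        update (suc u) _ rewrite out-zero-other {n} u =
          cong (λ V → lookup V u) (sym (labelBelow-replicate false t))

      treeLike : TreeLike circuit
      treeLike zero    notIn = (λ _ → proj₁ (pending zero notIn) refl) , λ notOut → ⊥-elim (notOut refl)
      treeLike (suc u) notIn = (λ o → ⊥-elim (body-noOutput u o)) ,
                               λ _ → proj₂ (pending (suc u) notIn) (lookup-replicate u false)

      level : Vec ℕ (suc (treeSize t n))
      level = suc (suc h) ∷ suc h ∷ labelBelow suc t (replicate n 0)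

      levels : Levels circuit level
      levels = levels-push {L = suc h ∷ labelBelow suc t (replicate n 0)} (out zero) (suc (suc h))
                           (compile-levels t base-levels base-layer) (λ _ ()) argument
        where
        argument : ∀ u → isPred {n} (out zero) u ≡ true → NonConst (kind body u) →
                   suc (lookup (suc h ∷ labelBelow suc t (replicate n 0)) u) ≡ suc (suc h)
        argument zero    _ _ = refl
        argument (suc u) e _ = ⊥-elim (true≢false (trans (sym e) (out-zero-other {n} u)))

      path-length : ∀ {u v m} → IsInput circuit u → Path circuit u v m → m ≡ lookup level v
      path-length {u} {v} {m} inp p = sym (begin
          lookup level v          ≡⟨ path-level levels p (input-nonConst circuit {u} inp) ⟩
          lookup level u + m      ≡⟨ cong (_+ m) (Levels.input-zero levels u inp) ⟩
          m                       ∎)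
        where open ≡-Reasoning

      leveled : Leveled circuit
      leveled u u′ v m m′ inp inp′ p p′ = trans (path-length inp p) (sym (path-length inp′ p′))

      depth : DepthAtMost circuit (suc (suc h))
      depth u zero    m inp _ p = ≤-reflexive (path-length inp p)
      depth u (suc v) m _   o _ = ⊥-elim (body-noOutput v o)

  module Transform {n : ℕ} (D : SOCircuit n) (d : ℕ) where
    open Formulas n
    open Trees n
    open Compilation n

    formula : Formula
    formula = lookup (formulas (circ D)) (output D)

    tree : Tree d
    tree = pad d formula

    open Compiled tree public using (soCircuit; treeLike; leveled; depth)

    formula-height : DepthAtMost (circ D) d → height formula ≤ d
    formula-height depth≤ with constValue formula in cv
    ... | just _  = ≤-trans (≤-reflexive (constValue-height formula cv)) z≤n
    ... | nothing with w , m , inp , p , h≤m ← formula-path (circ D) (output D) cv =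
      ≤-trans h≤m (depth≤ w (output D) m inp (outputOK D) p)

    sound : DepthAtMost (circ D) d → ∀ x → fun soCircuit x ≈ fun D x
    sound depth≤ x = ≈-trans (Compiled.sound tree x)
      (≈-trans (pad-sound x d formula (formula-height depth≤)) (formulas-sound (circ D) x (output D)))

    size-bound : size soCircuit ≤ suc ((2 + size D) ^ suc d + n)
    size-bound = s≤s (pad-size (size D) d formula n (formulas-fanIn (circ D) (output D)))

open CommutativeRing using (Carrier; _≈_)
open Circuits
open PolynomialBounds using (transform-polynomial)

lemma19 : {c ℓ : Level} (R : CommutativeRing c ℓ)
    (sign : Carrier R → Carrier R)
    (sign-cong : ∀ {a b} → _≈_ R a b → _≈_ R (sign a) (sign b))
    (C : Family R sign) → PolySize R sign C → ConstDepth R sign C →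
    ∃[ C' ] (PolySize R sign C' × ConstDepth R sign C'
      × ((n : ℕ) → TreeLike R sign (circuitOf R sign (C' n)))
      × ((n : ℕ) → Leveled R sign (circuitOf R sign (C' n)))
      × ((n : ℕ) (x : Fin n → Carrier R) → _≈_ R (fun R sign (C' n) x) (fun R sign (C n) x)))
lemma19 R sign sign-cong C (a , k , size≤) (d , depth≤) =
  C′ , polySize , (suc (suc d) , λ n → T.depth (C n) d) , (λ n → T.treeLike (C n) d) ,
  (λ n → T.leveled (C n) d) , (λ n → T.sound (C n) d (depth≤ n))
  where
  module T = Construction.Transform R sign sign-cong

  C′ : Family R sign
  C′ n = T.soCircuit (C n) d

  polySize : PolySize R sign C′
  polySize with a′ , k′ , bound ← transform-polynomial {a} {k} (λ n → size (C n)) size≤ d =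
    a′ , k′ , λ n → ≤-trans (T.size-bound (C n) d) (bound n)
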